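{- In the Slow Flashcard Game, for all integers $i\ge 2$ and $k\ge 1$ we have $T_i(1+k)<T_1(i+k)$.
   Context: The Slow Flashcard Game is the following deterministic process with insertion sequence $p_k=k+1$. The state at each time $t=1,2,\dots$ consists of an ordering (the deck) of all positive integers (cards), positions numbered $1,2,\dots$ from the front, together with a counter for each card recording how many times it has been seen. At time $t=1$ the deck is $1,2,3,\dots$, card $1$ (at the front) has been seen once, and all other cards $0$ times. To pass from time $t$ to $t+1$: if the front card has been seen $k$ times so far, remove it and reinsert it so that it occupies position $k+1$; then the card now at the front has its counter increased by one (it is seen at time $t+1$). For $n,k\ge1$, $T_n(k)$ denotes the time at which card $n$ is seen for the $k$-th time. -}

module Defs where

open import Data.Nat using (ℕ; zero; suc; _+_; _<ᵇ_; _≡ᵇ_)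
open import Data.Bool using (if_then_else_)
open import Data.Product using (_×_; _,_; proj₁; proj₂)
open import Relation.Binary.PropositionalEquality using (_≡_)

-- Conventions: cards are the positive integers 1,2,3,... (as ℕ values);
-- deck positions are 0-indexed internally (internal position j = paper's position j+1).
-- A state is (deck , counter): deck j = card at internal position j,
-- counter c = number of times card c has been seen so far.

Deck : Set
Deck = ℕ → ℕ

Counter : Set
Counter = ℕ → ℕ

State : Set
State = Deck × Counter

-- Insertion sequence p_k = k + 1 (paper's 1-indexed position).
p : ℕ → ℕ
p k = suc k

-- Remove the front card c and reinsert it so that it occupies (1-indexed)
-- position m (m ≥ 1), i.e. internal position m - 1.
reinsert : ℕ → Deck → Deck
reinsert (suc i) d j = if j <ᵇ i then d (suc j) else (if j ≡ᵇ i then d 0 else d j)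
reinsert zero d j = d j   -- never used (p k ≥ 1)

step : State → State
step (d , cnt) =
  let d' = reinsert (p (cnt (d 0))) d
  in d' , (λ x → if x ≡ᵇ d' 0 then suc (cnt x) else cnt x)

-- Initial state (time 1): deck 1,2,3,...; card 1 seen once, others 0 times.
initial : State
initial = (λ j → suc j) , (λ x → if x ≡ᵇ 1 then 1 else 0)

-- stateAt m is the state at time t = m + 1.
stateAt : ℕ → State
stateAt zero = initial
stateAt (suc m) = step (stateAt m)

-- SeenAt t n k : at time t (≥ 1) card n is seen, and this is its k-th sighting,
-- i.e. t = T_n(k).
SeenAt : ℕ → ℕ → ℕ → Set
SeenAt zero n k = Data.Nat.zero ≡ suc zero   -- there is no time 0 (uninhabited)
SeenAt (suc m) n k = (proj₁ (stateAt m) 0 ≡ n) × (proj₂ (stateAt m) n ≡ k)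

-- Let N be the largest card seen so far. Along the game every card x < N has been seen at least
-- N + [x ≥ 2] − x times, with equality only while x lies strictly between the front and card N + 1,
-- and no card has been seen more than N times.  When card i ≥ 2 is seen for the (k+1)-th time it is
-- at the front, which excludes the equality case: i = N or N + 1 < (k + 1) + i.  Either way card 1
-- has been seen fewer than i + k times, so T_i(1 + k) < T_1(i + k) as counters never decrease.  Both
-- sightings exist because N is unbounded: until card N + 1 reaches the front, every step lowers the
-- total number of sightings that the cards ahead of it still need to reach N.
module Submission where

open import Data.Bool using (true; false; if_then_else_)
open import Data.Empty using (⊥-elim)
open import Data.Nat
open import Data.Nat.Induction using (<-wellFounded)
open import Data.Nat.Properties
open import Data.Product using (Σ; ∃; _×_; _,_; proj₁; proj₂)
open import Data.Sum using (_⊎_; inj₁; inj₂)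
open import Data.Unit using (tt)
open import Function using (_∘_)
open import Induction.WellFounded using (Acc; acc)
open import Relation.Binary.Definitions using (tri<; tri≈; tri>)
open import Relation.Binary.PropositionalEquality
open import Relation.Nullary using (yes; no)

open import Defs

<ᵇ-true : ∀ {m n} → m < n → (m <ᵇ n) ≡ true
<ᵇ-true {m} {n} m<n with m <ᵇ n | <⇒<ᵇ m<n
... | true | _ = refl

<ᵇ-false : ∀ {m n} → n ≤ m → (m <ᵇ n) ≡ false
<ᵇ-false {m} {n} n≤m with m <ᵇ n | <ᵇ⇒< m n
... | false | _   = refl
... | true  | m<n = ⊥-elim (<⇒≱ (m<n tt) n≤m)

≡ᵇ-refl : ∀ n → (n ≡ᵇ n) ≡ true
≡ᵇ-refl zero    = refl
≡ᵇ-refl (suc n) = ≡ᵇ-refl n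

≡ᵇ-false : ∀ {m n} → m ≢ n → (m ≡ᵇ n) ≡ false
≡ᵇ-false {m} {n} m≢n with m ≡ᵇ n | ≡ᵇ⇒≡ m n
... | false | _   = refl
... | true  | m≡n = ⊥-elim (m≢n (m≡n tt))

-- The position that the card at position a moves to when the front card is reinserted at position i.
newPosition : ℕ → ℕ → ℕ
newPosition i zero    = i
newPosition i (suc a) = if a <ᵇ i then a else suc a

newPosition-< : ∀ {i a} → a < i → newPosition i (suc a) ≡ a
newPosition-< a<i rewrite <ᵇ-true a<i = refl

newPosition-≥ : ∀ {i a} → i ≤ a → newPosition i (suc a) ≡ suc a
newPosition-≥ i≤a rewrite <ᵇ-false i≤a = refl

newPosition-beyond : ∀ {i a} → i < a → newPosition i a ≡ a
newPosition-beyond {a = suc a} (s≤s i≤a) = newPosition-≥ i≤a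

newPosition-ahead : ∀ {i a} → 1 ≤ a → a ≤ i → newPosition i a < i
newPosition-ahead {a = suc a} _ a<i rewrite newPosition-< a<i = a<i

newPosition-mono : ∀ i {a b} → 1 ≤ a → a < b → newPosition i a < newPosition i b
newPosition-mono i {suc a} {suc b} _ (s≤s a<b) with a <? i | b <? i
... | yes a<i | yes b<i rewrite newPosition-< a<i | newPosition-< b<i = a<b
... | yes a<i | no  b≮i rewrite newPosition-< a<i | newPosition-≥ (≮⇒≥ b≮i) = m<n⇒m<1+n a<b
... | no  a≮i | yes b<i = ⊥-elim (a≮i (<-trans a<b b<i))
... | no  a≮i | no  b≮i rewrite newPosition-≥ (≮⇒≥ a≮i) | newPosition-≥ (≮⇒≥ b≮i) = s≤s a<b

newPosition-≤ : ∀ i {a K} → a ≤ K → i ≤ K → newPosition i a ≤ K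
newPosition-≤ i {zero}  _   i≤K = i≤K
newPosition-≤ i {suc a} a≤K _   with a <? i
... | yes a<i rewrite newPosition-< a<i = ≤-trans (n≤1+n a) a≤K
... | no  a≮i rewrite newPosition-≥ (≮⇒≥ a≮i) = a≤K

module _ (i : ℕ) (d : Deck) where

  reinsert-< : ∀ {j} → j < i → reinsert (suc i) d j ≡ d (suc j)
  reinsert-< j<i rewrite <ᵇ-true j<i = refl

  reinsert-≡ : reinsert (suc i) d i ≡ d 0
  reinsert-≡ rewrite <ᵇ-false (≤-refl {i}) | ≡ᵇ-refl i = refl

  reinsert-> : ∀ {j} → i < j → reinsert (suc i) d j ≡ d j
  reinsert-> {j} i<j rewrite <ᵇ-false (<⇒≤ i<j) | ≡ᵇ-false (≢-sym (<⇒≢ i<j)) = refl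

  reinsert-preserves : (P : ℕ → Set) → (∀ j → P (d j)) → ∀ j → P (reinsert (suc i) d j)
  reinsert-preserves P P-d j with <-cmp j i
  ... | tri< j<i _ _ rewrite reinsert-< j<i = P-d (suc j)
  ... | tri≈ _ refl _ rewrite reinsert-≡ = P-d 0
  ... | tri> _ _ i<j rewrite reinsert-> i<j = P-d j

  reinsert-newPosition : ∀ a → reinsert (suc i) d (newPosition i a) ≡ d a
  reinsert-newPosition zero = reinsert-≡
  reinsert-newPosition (suc a) with a <? i
  ... | yes a<i rewrite newPosition-< a<i = reinsert-< a<i
  ... | no  a≮i rewrite newPosition-≥ (≮⇒≥ a≮i) = reinsert-> (s≤s (≮⇒≥ a≮i))

  newPosition-reinsert : (pos : ℕ → ℕ) → (∀ j → pos (d j) ≡ j) →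
                         ∀ j → newPosition i (pos (reinsert (suc i) d j)) ≡ j
  newPosition-reinsert pos pos-d j with <-cmp j i
  ... | tri< j<i _ _ rewrite reinsert-< j<i | pos-d (suc j) = newPosition-< j<i
  ... | tri≈ _ refl _ rewrite reinsert-≡ | pos-d 0 = refl
  newPosition-reinsert pos pos-d (suc j) | tri> _ _ i<j
    rewrite reinsert-> i<j | pos-d (suc j) = newPosition-≥ (≤-pred i<j)

see : ℕ → Counter → Counter
see y c x = if x ≡ᵇ y then suc (c x) else c x

see-hit : ∀ {y c x} → x ≡ y → see y c x ≡ suc (c x)
see-hit {x = x} refl rewrite ≡ᵇ-refl x = refl

see-miss : ∀ {y c x} → x ≢ y → see y c x ≡ c x
see-miss x≢y rewrite ≡ᵇ-false x≢y = refl

see-≥ : ∀ y c x → c x ≤ see y c x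
see-≥ y c x with x ≟ y
... | yes x≡y rewrite see-hit {c = c} x≡y = n≤1+n (c x)
... | no  x≢y rewrite see-miss {c = c} x≢y = ≤-refl

sumTo : ℕ → (ℕ → ℕ) → ℕ
sumTo zero    f = 0
sumTo (suc n) f = f (suc n) + sumTo n f

module _ {f g : ℕ → ℕ} where

  private
    restrict : ∀ {n} → (∀ x → 1 ≤ x → x ≤ suc n → f x ≤ g x) →
                        ∀ x → 1 ≤ x → x ≤ n     → f x ≤ g x
    restrict f≤g x 1≤x x≤n = f≤g x 1≤x (m≤n⇒m≤1+n x≤n)

  sumTo-mono : ∀ n → (∀ x → 1 ≤ x → x ≤ n → f x ≤ g x) → sumTo n f ≤ sumTo n g
  sumTo-mono zero    _   = z≤n
  sumTo-mono (suc n) f≤g = +-mono-≤ (f≤g (suc n) (s≤s z≤n) ≤-refl) (sumTo-mono n (restrict f≤g))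

  sumTo-mono-< : ∀ n {z} → (∀ x → 1 ≤ x → x ≤ n → f x ≤ g x) →
                 1 ≤ z → z ≤ n → f z < g z → sumTo n f < sumTo n g
  sumTo-mono-< zero    _   1≤z z≤0 _ = ⊥-elim (<⇒≱ 1≤z z≤0)
  sumTo-mono-< (suc n) f≤g 1≤z z≤1+n fz<gz with m≤n⇒m<n∨m≡n z≤1+n
  ... | inj₂ refl  = +-mono-<-≤ fz<gz (sumTo-mono n (restrict f≤g))
  ... | inj₁ z<1+n = +-mono-≤-< (f≤g (suc n) (s≤s z≤n) ≤-refl)
                                (sumTo-mono-< n (restrict f≤g) 1≤z (≤-pred z<1+n) fz<gz)

later : ℕ → ℕ
later (suc (suc _)) = 1
later _             = 0

later-≥2 : ∀ {x} → 2 ≤ x → later x ≡ 1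
later-≥2 (s≤s (s≤s _)) = refl

-- The sightings card x still needs to reach N, counted only while x is ahead of card N + 1.
arrear : (pos : ℕ → ℕ) → Counter → ℕ → ℕ → ℕ
arrear pos c N x = if pos x <ᵇ pos (suc N) then N ∸ c x else 0

arrears : (pos : ℕ → ℕ) → Counter → ℕ → ℕ
arrears pos c N = sumTo N (arrear pos c N)

module _ {pos pos' : ℕ → ℕ} {c c' : Counter} {N x : ℕ} where

  arrear-mono : (pos' x < pos' (suc N) → pos x < pos (suc N)) → c x ≤ c' x →
                arrear pos' c' N x ≤ arrear pos c N x
  arrear-mono ahead c≤c' with pos' x <? pos' (suc N)
  ... | no  behind' rewrite <ᵇ-false (≮⇒≥ behind') = z≤n
  ... | yes ahead'  rewrite <ᵇ-true ahead' | <ᵇ-true (ahead ahead') = ∸-monoʳ-≤ N c≤c'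

  arrear-mono-< : pos' x < pos' (suc N) → pos x < pos (suc N) → c x < c' x → c' x ≤ N →
                  arrear pos' c' N x < arrear pos c N x
  arrear-mono-< ahead' ahead c<c' c'≤N rewrite <ᵇ-true ahead' | <ᵇ-true ahead = ∸-monoʳ-< c<c' c'≤N

-- N is the largest card seen so far and pos is the inverse of the deck d.
record Invariant (d : Deck) (c : Counter) (pos : ℕ → ℕ) (N : ℕ) : Set where
  field
    deck-pos        : ∀ x → 1 ≤ x → d (pos x) ≡ x
    pos-deck        : ∀ j → pos (d j) ≡ j
    deck-positive   : ∀ j → 1 ≤ d j
    unmoved         : ∀ x → 2 + N ≤ x → pos x ≡ pred x
    next-not-front  : 1 ≤ pos (suc N)
    N≥2             : 2 ≤ N
    front-seen      : 1 ≤ c (d 0)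
    unseen          : ∀ x → suc N ≤ x → c x ≡ 0
    seen≤N          : ∀ x → 1 ≤ x → c x ≤ N
    seenN-placement : ∀ x → 1 ≤ x → c x ≡ N → pos x ≡ 0 ⊎ pos (suc N) < pos x
    seen-lower      : ∀ x → 1 ≤ x → x < N →
                        (0 < pos x × pos x < pos (suc N) × N + later x ≤ c x + x)
                        ⊎ N + later x < c x + x
    seen-lower-top  : 2 ≤ c N ⊎ (c N ≡ 1 × pos N ≤ 1 × 2 ≤ pos (suc N))

module InvariantProperties {d c pos N} (I : Invariant d c pos N) where
  open Invariant I

  pos-injective : ∀ {x y} → 1 ≤ x → 1 ≤ y → pos x ≡ pos y → x ≡ y
  pos-injective {x} {y} 1≤x 1≤y eq = trans (sym (deck-pos x 1≤x)) (trans (cong d eq) (deck-pos y 1≤y))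

  at-position : ∀ {x} j → 1 ≤ x → pos x ≡ j → x ≡ d j
  at-position {x} j 1≤x eq = trans (sym (deck-pos x 1≤x)) (cong d eq)

  unseen-not-front : ∀ {x} → suc N ≤ x → 1 ≤ pos x
  unseen-not-front {x} N<x with m≤n⇒m<n∨m≡n N<x
  ... | inj₂ refl   = next-not-front
  ... | inj₁ 1+N<x rewrite unmoved x 1+N<x = ≤-trans (s≤s z≤n) (pred-mono-≤ 1+N<x)

  pos≤N : ∀ {x} → 1 ≤ x → x ≤ suc N → pos x ≤ N
  pos≤N {x} 1≤x x≤1+N with pos x ≤? N
  ... | yes ok = ok
  ... | no  N<pos = ⊥-elim (<⇒≱ (s≤s (≰⇒> N<pos)) (subst (_≤ suc N) (sym card-behind) x≤1+N))
    where
      card-behind : suc (pos x) ≡ x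
      card-behind = pos-injective (s≤s z≤n) 1≤x (unmoved (suc (pos x)) (s≤s (≰⇒> N<pos)))

  front≤N : d 0 ≤ N
  front≤N with d 0 ≤? N
  ... | yes ok = ok
  ... | no  N<d0 = ⊥-elim (1+n≰n (subst (1 ≤_) (pos-deck 0) (unseen-not-front (≰⇒> N<d0))))

  second≤1+N : d 1 ≤ suc N
  second≤1+N with d 1 ≤? suc N
  ... | yes ok = ok
  ... | no  1+N<d1 = ⊥-elim (<⇒≢ 1<pred (trans (sym (pos-deck 1)) (unmoved (d 1) (≰⇒> 1+N<d1))))
    where
      1<pred : 1 < pred (d 1)
      1<pred = ≤-trans N≥2 (≤-trans (n≤1+n N) (pred-mono-≤ (≰⇒> 1+N<d1)))

  second-count<N : c (d 1) < N
  second-count<N = ≤∧≢⇒< (seen≤N (d 1) (deck-positive 1)) not-N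
    where
      not-N : c (d 1) ≢ N
      not-N cN with seenN-placement (d 1) (deck-positive 1) cN
      ... | inj₁ at-front = 1+n≢0 (trans (sym (pos-deck 1)) at-front)
      ... | inj₂ behind   = <⇒≱ (subst (pos (suc N) <_) (pos-deck 1) behind) next-not-front

  N≤count+card : ∀ {x} → 1 ≤ x → x < N → N ≤ c x + x
  N≤count+card {x} 1≤x x<N with seen-lower x 1≤x x<N
  ... | inj₁ (_ , _ , bound) = ≤-trans (m≤m+n N (later x)) bound
  ... | inj₂ bound           = ≤-trans (m≤m+n N (later x)) (<⇒≤ bound)

  count-lower : ∀ {x v} → 1 ≤ x → 1 ≤ v → x + v ≤ N → v ≤ c x
  count-lower {x} {v} 1≤x 1≤v x+v≤N =
    +-cancelʳ-≤ x v (c x) (≤-trans (≤-reflexive (+-comm v x))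
                            (≤-trans x+v≤N (N≤count+card 1≤x (<-≤-trans (m<m+n x 1≤v) x+v≤N))))

  count-of-1-at-sighting : ∀ {i k} → 2 ≤ i → 1 ≤ k → d 0 ≡ i → c i ≡ suc k → c 1 < i + k
  count-of-1-at-sighting {i} {k} i≥2 k≥1 d0≡i ci≡1+k with m≤n⇒m<n∨m≡n (subst (_≤ N) d0≡i front≤N)
  ... | inj₂ refl = ≤-<-trans (seen≤N 1 (s≤s z≤n)) (m<m+n i k≥1)
  ... | inj₁ i<N with seen-lower i (≤-trans (s≤s z≤n) i≥2) i<N
  ...   | inj₁ (behind-front , _) =
          ⊥-elim (<⇒≢ behind-front (sym (trans (cong pos (sym d0≡i)) (pos-deck 0))))
  ...   | inj₂ bound = begin-strict
          c 1        <⟨ s≤s (seen≤N 1 (s≤s z≤n)) ⟩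
          suc N      ≡⟨ +-comm 1 N ⟩
          N + 1      ≤⟨ ≤-pred (subst₂ (λ l r → N + l < r + i) (later-≥2 i≥2) ci≡1+k bound) ⟩
          k + i      ≡⟨ +-comm k i ⟩
          i + k      ∎
    where open ≤-Reasoning

-- d' and c' are definitionally the deck and counters produced by `step`.
module Step {d c pos N} (I : Invariant d c pos N) where
  open Invariant I
  open InvariantProperties I

  i : ℕ
  i = c (d 0)

  d' : Deck
  d' = reinsert (suc i) d

  c' : Counter
  c' = see (d' 0) c

  pos' : ℕ → ℕ
  pos' x = newPosition i (pos x)

  second-to-front : d' 0 ≡ d 1
  second-to-front = reinsert-< i d front-seen

  deck-pos' : ∀ x → 1 ≤ x → d' (pos' x) ≡ x
  deck-pos' x 1≤x = trans (reinsert-newPosition i d (pos x)) (deck-pos x 1≤x)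

  pos-deck' : ∀ j → pos' (d' j) ≡ j
  pos-deck' = newPosition-reinsert i d pos pos-deck

  unmoved' : ∀ x → 2 + N ≤ x → pos' x ≡ pred x
  unmoved' x@(suc (suc y)) 2+N≤x@(s≤s (s≤s N≤y)) rewrite unmoved x 2+N≤x =
    newPosition-≥ (≤-trans (seen≤N (d 0) (deck-positive 0)) N≤y)

  pos'-second : pos' (d 1) ≡ 0
  pos'-second = trans (cong pos' (sym second-to-front)) (pos-deck' 0)

  pos'-positive : ∀ {x} → 1 ≤ x → x ≢ d 1 → 1 ≤ pos' x
  pos'-positive {x} 1≤x x≢d1 with pos' x in eq
  ... | zero  = ⊥-elim (x≢d1 (trans (sym (deck-pos' x 1≤x)) (trans (cong d' eq) second-to-front)))
  ... | suc _ = s≤s z≤n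

  c'-hit : c' (d 1) ≡ suc (c (d 1))
  c'-hit = see-hit {c = c} (sym second-to-front)

  c'-miss : ∀ {x} → x ≢ d 1 → c' x ≡ c x
  c'-miss x≢d1 = see-miss {c = c} λ x≡d'0 → x≢d1 (trans x≡d'0 second-to-front)

  front-seen' : 1 ≤ c' (d' 0)
  front-seen' = subst (1 ≤_) (sym (see-hit {c = c} refl)) (s≤s z≤n)

  unseen' : ∀ x → suc N ≤ x → x ≢ d 1 → c' x ≡ 0
  unseen' x N<x x≢d1 = trans (c'-miss x≢d1) (unseen x N<x)

  seen≤N' : ∀ x → 1 ≤ x → c' x ≤ N
  seen≤N' x 1≤x with x ≟ d 1
  ... | yes refl = subst (_≤ N) (sym c'-hit) second-count<N
  ... | no  x≢d1 = subst (_≤ N) (sym (c'-miss x≢d1)) (seen≤N x 1≤x)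

  seenN-placement' : ∀ x → 1 ≤ x → c' x ≡ N → pos' x ≡ 0 ⊎ pos' (suc N) < pos' x
  seenN-placement' x 1≤x c'x≡N with x ≟ d 1
  ... | yes refl = inj₁ pos'-second
  ... | no  x≢d1 with seenN-placement x 1≤x (trans (sym (c'-miss x≢d1)) c'x≡N)
  ...   | inj₂ behind   = inj₂ (newPosition-mono i next-not-front behind)
  ...   | inj₁ at-front = inj₂ (subst (pos' (suc N) <_) (cong (newPosition i) (sym at-front))
                                  (newPosition-ahead next-not-front (subst (pos (suc N) ≤_) (sym i≡N)
                                                                       (pos≤N (s≤s z≤n) ≤-refl))))
    where
      -- x was the front card, so it was reinserted at position N, behind card N + 1
      i≡N : i ≡ N
      i≡N = trans (cong c (sym (at-position 0 1≤x at-front))) (trans (sym (c'-miss x≢d1)) c'x≡N)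

  seen-lower' : ∀ x → 1 ≤ x → x < N →
                  (0 < pos' x × pos' x < pos' (suc N) × N + later x ≤ c' x + x)
                  ⊎ N + later x < c' x + x
  seen-lower' x 1≤x x<N with seen-lower x 1≤x x<N
  ... | inj₂ bound = inj₂ (≤-trans bound (+-monoˡ-≤ x (see-≥ (d' 0) c x)))
  ... | inj₁ (behind-front , ahead , bound) with x ≟ d 1
  ...   | yes refl = inj₂ (subst (λ n → N + later x < n + x) (sym c'-hit) (s≤s bound))
  ...   | no  x≢d1 = inj₁ ( pos'-positive 1≤x x≢d1
                          , newPosition-mono i behind-front ahead
                          , subst (λ n → N + later x ≤ n + x) (sym (c'-miss x≢d1)) bound )

  seen-lower-top' : 2 ≤ c' N ⊎ (c' N ≡ 1 × pos' N ≤ 1 × 2 ≤ pos' (suc N))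
  seen-lower-top' with seen-lower-top
  ... | inj₁ 2≤cN = inj₁ (≤-trans 2≤cN (see-≥ (d' 0) c N))
  ... | inj₂ (cN≡1 , posN≤1 , 2≤posF) with n≤1⇒n≡0∨n≡1 posN≤1
  ...   | inj₂ posN = inj₁ (≤-reflexive (sym c'N≡2))
    where
      N≡d1 : N ≡ d 1
      N≡d1 = at-position 1 (≤-trans (s≤s z≤n) N≥2) posN

      c'N≡2 : c' N ≡ 2
      c'N≡2 = begin
        c' N            ≡⟨ cong c' N≡d1 ⟩
        c' (d 1)        ≡⟨ c'-hit ⟩
        suc (c (d 1))   ≡⟨ cong (suc ∘ c) (sym N≡d1) ⟩
        suc (c N)       ≡⟨ cong suc cN≡1 ⟩
        2               ∎
        where open ≡-Reasoning
  ...   | inj₁ posN = inj₂ ( trans (c'-miss N≢d1) cN≡1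
                          , ≤-reflexive (trans (cong (newPosition i) posN) i≡1)
                          , subst (2 ≤_) (sym (newPosition-beyond (subst (_< pos (suc N)) (sym i≡1) 2≤posF)))
                                  2≤posF )
    where
      N≡d0 : N ≡ d 0
      N≡d0 = at-position 0 (≤-trans (s≤s z≤n) N≥2) posN
      N≢d1 : N ≢ d 1
      N≢d1 N≡d1 = 1+n≢0 (trans (sym (pos-deck 1)) (trans (cong pos (sym N≡d1)) posN))
      i≡1 : i ≡ 1
      i≡1 = trans (cong c (sym N≡d0)) cN≡1

  ahead-before : ∀ {x} → 1 ≤ x → x ≤ N → pos' x < pos' (suc N) → pos x < pos (suc N)
  ahead-before {x} 1≤x x≤N ahead' with <-cmp (pos x) (pos (suc N))
  ... | tri< ahead _ _ = ahead
  ... | tri≈ _ same _  = ⊥-elim (1+n≰n (subst (_≤ N) (pos-injective 1≤x (s≤s z≤n) same) x≤N))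
  ... | tri> _ _ behind = ⊥-elim (<-asym ahead' (newPosition-mono i next-not-front behind))

  module OldMaximum (d1≢1+N : d 1 ≢ suc N) where

    d1≤N : d 1 ≤ N
    d1≤N = ≤-pred (≤∧≢⇒< second≤1+N d1≢1+N)

    invariant : Invariant d' c' pos' N
    invariant = record
      { deck-pos        = deck-pos'
      ; pos-deck        = pos-deck'
      ; deck-positive   = reinsert-preserves i d (1 ≤_) deck-positive
      ; unmoved         = unmoved'
      ; next-not-front  = pos'-positive (s≤s z≤n) (≢-sym d1≢1+N)
      ; N≥2             = N≥2
      ; front-seen      = front-seen'
      ; unseen          = λ x N<x → unseen' x N<x λ x≡d1 → <⇒≱ N<x (subst (_≤ N) (sym x≡d1) d1≤N)
      ; seen≤N          = seen≤N'
      ; seenN-placement = seenN-placement'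
      ; seen-lower      = seen-lower'
      ; seen-lower-top  = seen-lower-top'
      }

    2≤pos-next : 2 ≤ pos (suc N)
    2≤pos-next = ≤∧≢⇒< next-not-front λ 1≡pos → d1≢1+N (sym (at-position 1 (s≤s z≤n) (sym 1≡pos)))

    arrears-decrease : arrears pos' c' N < arrears pos c N
    arrears-decrease = sumTo-mono-< N pointwise (deck-positive 1) d1≤N at-second
      where
        pointwise : ∀ x → 1 ≤ x → x ≤ N → arrear pos' c' N x ≤ arrear pos c N x
        pointwise x 1≤x x≤N = arrear-mono {pos} {pos'} {c} {c'} {N} {x}
                                (ahead-before 1≤x x≤N) (see-≥ (d' 0) c x)

        -- card d 1 is ahead of card N + 1 both before and after the step, and is seen
        at-second : arrear pos' c' N (d 1) < arrear pos c N (d 1)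
        at-second = arrear-mono-< {pos} {pos'} {c} {c'} {N} {d 1}
          (subst (_< pos' (suc N)) (sym pos'-second) (pos'-positive (s≤s z≤n) (≢-sym d1≢1+N)))
          (subst (_< pos (suc N)) (sym (pos-deck 1)) 2≤pos-next)
          (subst (c (d 1) <_) (sym c'-hit) ≤-refl)
          (subst (_≤ N) (sym c'-hit) second-count<N)

    maximum : N ⊔ d' 0 ≡ N
    maximum = m≥n⇒m⊔n≡m (subst (_≤ N) (sym second-to-front) d1≤N)

  module NewMaximum (d1≡1+N : d 1 ≡ suc N) where

    pos'-next-next : pos' (2 + N) ≡ suc N
    pos'-next-next = unmoved' (2 + N) ≤-refl

    pos-next≡1 : pos (suc N) ≡ 1
    pos-next≡1 = trans (cong pos (sym d1≡1+N)) (pos-deck 1)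

    pos'-next≡0 : pos' (suc N) ≡ 0
    pos'-next≡0 = trans (cong pos' (sym d1≡1+N)) pos'-second

    c'-next≡1 : c' (suc N) ≡ 1
    c'-next≡1 = begin
      c' (suc N)      ≡⟨ cong c' (sym d1≡1+N) ⟩
      c' (d 1)        ≡⟨ c'-hit ⟩
      suc (c (d 1))   ≡⟨ cong (suc ∘ c) d1≡1+N ⟩
      suc (c (suc N)) ≡⟨ cong suc (unseen (suc N) ≤-refl) ⟩
      1               ∎
      where open ≡-Reasoning

    not-front' : ∀ {x} → 1 ≤ x → x ≤ N → 0 < pos' x
    not-front' 1≤x x≤N = pos'-positive 1≤x (λ x≡d1 → 1+n≰n (subst (_≤ N) (trans x≡d1 d1≡1+N) x≤N))

    ahead-of-next' : ∀ {x} → 1 ≤ x → x ≤ N → pos' x < pos' (2 + N)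
    ahead-of-next' 1≤x x≤N = subst (pos' _ <_) (sym pos'-next-next)
      (s≤s (newPosition-≤ i (pos≤N 1≤x (m≤n⇒m≤1+n x≤N)) (seen≤N (d 0) (deck-positive 0))))

    seen-lower-new : ∀ x → 1 ≤ x → x < suc N →
                       (0 < pos' x × pos' x < pos' (2 + N) × suc N + later x ≤ c' x + x)
                       ⊎ suc N + later x < c' x + x
    seen-lower-new x 1≤x x≤N with m≤n⇒m<n∨m≡n (≤-pred x≤N)
    ... | inj₁ x<N with seen-lower x 1≤x x<N
    ...   | inj₁ (behind-front , ahead , _) =
            ⊥-elim (<⇒≱ ahead (subst (_≤ pos x) (sym pos-next≡1) behind-front))
    ...   | inj₂ bound = inj₁ ( not-front' 1≤x (<⇒≤ x<N) , ahead-of-next' 1≤x (<⇒≤ x<N)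
                              , ≤-trans bound (+-monoˡ-≤ x (see-≥ (d' 0) c x)) )
    seen-lower-new x 1≤x x≤N | inj₂ refl with seen-lower-top
    ... | inj₂ (_ , _ , 2≤pos-next) = ⊥-elim (1+n≰n (subst (2 ≤_) pos-next≡1 2≤pos-next))
    ... | inj₁ 2≤cN = inj₁ ( not-front' 1≤x ≤-refl , ahead-of-next' 1≤x ≤-refl
                           , (begin
                               suc N + later N ≡⟨ cong (suc N +_) (later-≥2 N≥2) ⟩
                               suc N + 1       ≡⟨ +-comm (suc N) 1 ⟩
                               2 + N           ≤⟨ +-monoˡ-≤ N (≤-trans 2≤cN (see-≥ (d' 0) c N)) ⟩
                               c' N + N        ∎) )
      where open ≤-Reasoning

    invariant : Invariant d' c' pos' (suc N)
    invariant = record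
      { deck-pos        = deck-pos'
      ; pos-deck        = pos-deck'
      ; deck-positive   = reinsert-preserves i d (1 ≤_) deck-positive
      ; unmoved         = λ x 3+N≤x → unmoved' x (<⇒≤ 3+N≤x)
      ; next-not-front  = subst (1 ≤_) (sym pos'-next-next) (s≤s z≤n)
      ; N≥2             = m≤n⇒m≤1+n N≥2
      ; front-seen      = front-seen'
      ; unseen          = λ x 1+N<x → unseen' x (<⇒≤ 1+N<x)
                                        λ x≡d1 → 1+n≰n (subst (suc (suc N) ≤_) (trans x≡d1 d1≡1+N) 1+N<x)
      ; seen≤N          = λ x 1≤x → m≤n⇒m≤1+n (seen≤N' x 1≤x)
      ; seenN-placement = λ x 1≤x c'x≡1+N → ⊥-elim (1+n≰n (subst (_≤ N) c'x≡1+N (seen≤N' x 1≤x)))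
      ; seen-lower      = seen-lower-new
      ; seen-lower-top  = inj₂ ( c'-next≡1
                               , subst (_≤ 1) (sym pos'-next≡0) z≤n
                               , subst (2 ≤_) (sym pos'-next-next) (s≤s (≤-trans (s≤s z≤n) N≥2)) )
      }

    maximum : N ⊔ d' 0 ≡ suc N
    maximum = trans (m≤n⇒m⊔n≡n (subst (N ≤_) (sym d'0≡1+N) (n≤1+n N))) d'0≡1+N
      where
        d'0≡1+N : d' 0 ≡ suc N
        d'0≡1+N = trans second-to-front d1≡1+N

  invariant : Invariant d' c' pos' (N ⊔ d' 0)
  invariant with d 1 ≟ suc N
  ... | yes new = subst (Invariant d' c' pos') (sym (NewMaximum.maximum new)) (NewMaximum.invariant new)
  ... | no  old = subst (Invariant d' c' pos') (sym (OldMaximum.maximum old)) (OldMaximum.invariant old)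

deckAt : ℕ → Deck
deckAt m = proj₁ (stateAt m)

countAt : ℕ → Counter
countAt m = proj₂ (stateAt m)

posAt : ℕ → ℕ → ℕ
posAt zero    x = pred x
posAt (suc m) x = newPosition (countAt m (deckAt m 0)) (posAt m x)

maxSeen : ℕ → ℕ
maxSeen zero    = 1
maxSeen (suc m) = maxSeen m ⊔ deckAt (suc m) 0

-- The invariant holds from time 2 on: the deck is then 2, 1, 3, 4, … and cards 1, 2 have been seen once.
invariant-2 : Invariant (deckAt 1) (countAt 1) (posAt 1) (maxSeen 1)
invariant-2 = record
  { deck-pos        = λ { 1 _ → refl ; 2 _ → refl ; (suc (suc (suc _))) _ → refl }
  ; pos-deck        = λ { 0 → refl ; 1 → refl ; (suc (suc _)) → refl }
  ; deck-positive   = λ { 0 → s≤s z≤n ; 1 → s≤s z≤n ; (suc (suc _)) → s≤s z≤n }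
  ; unmoved         = λ { _ (s≤s (s≤s (s≤s (s≤s _)))) → refl }
  ; next-not-front  = s≤s z≤n
  ; N≥2             = ≤-refl
  ; front-seen      = ≤-refl
  ; unseen          = λ { _ (s≤s (s≤s (s≤s _))) → refl }
  ; seen≤N          = λ { 1 _ → s≤s z≤n ; 2 _ → s≤s z≤n ; (suc (suc (suc _))) _ → z≤n }
  ; seenN-placement = λ { 1 _ () ; 2 _ () ; (suc (suc (suc _))) _ () }
  ; seen-lower      = λ { 1 _ _ → inj₁ (≤-refl , ≤-refl , ≤-refl) ; (suc (suc _)) _ (s≤s (s≤s ())) }
  ; seen-lower-top  = inj₂ (refl , z≤n , ≤-refl)
  }

invariantAt : ∀ m → Invariant (deckAt (suc m)) (countAt (suc m)) (posAt (suc m)) (maxSeen (suc m))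
invariantAt zero    = invariant-2
invariantAt (suc m) = Step.invariant (invariantAt m)

arrearsAt : ℕ → ℕ
arrearsAt m = arrears (posAt (suc m)) (countAt (suc m)) (maxSeen (suc m))

maxSeen-grows : ∀ m → Acc _<_ (arrearsAt m) → ∃ λ m' → maxSeen (suc m) < maxSeen (suc m')
maxSeen-grows m (acc smaller) with deckAt (suc m) 1 ≟ suc (maxSeen (suc m))
... | yes new = suc m , ≤-reflexive (sym (Step.NewMaximum.maximum (invariantAt m) new))
... | no  old = let m' , grows = maxSeen-grows (suc m) (smaller decreasing)
                in  m' , subst (_< maxSeen (suc m')) unchanged grows
  where
    open Step (invariantAt m) using (module OldMaximum)

    unchanged : maxSeen (suc (suc m)) ≡ maxSeen (suc m)
    unchanged = OldMaximum.maximum old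

    decreasing : arrearsAt (suc m) < arrearsAt m
    decreasing = subst (λ n → arrears (posAt (suc (suc m))) (countAt (suc (suc m))) n < arrearsAt m)
                       (sym unchanged) (OldMaximum.arrears-decrease old)

maxSeen-unbounded : ∀ K → ∃ λ m → K ≤ maxSeen (suc m)
maxSeen-unbounded zero    = 0 , z≤n
maxSeen-unbounded (suc K) =
  let m  , K≤N  = maxSeen-unbounded K
      m' , N<N' = maxSeen-grows m (<-wellFounded (arrearsAt m))
  in  m' , ≤-<-trans K≤N N<N'

count-initial : ∀ x → countAt 0 x ≤ 1
count-initial 0             = z≤n
count-initial 1             = ≤-refl
count-initial (suc (suc _)) = z≤n

count-mono : ∀ x {m m'} → m ≤ m' → countAt m x ≤ countAt m' x
count-mono x m≤m' = go (≤⇒≤′ m≤m')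
  where
    go : ∀ {m m'} → m ≤′ m' → countAt m x ≤ countAt m' x
    go ≤′-refl              = ≤-refl
    go (≤′-step {m'} m≤′m') = ≤-trans (go m≤′m') (see-≥ (deckAt (suc m') 0) (countAt m') x)

-- Counters start at most 1 and grow by steps of 1, each increase being a sighting.
sighted-with-count : ∀ m x v → 2 ≤ v → v ≤ countAt m x →
                     ∃ λ m' → deckAt m' 0 ≡ x × countAt m' x ≡ v
sighted-with-count zero    x v 2≤v v≤count = ⊥-elim (<⇒≱ 2≤v (≤-trans v≤count (count-initial x)))
sighted-with-count (suc m) x v 2≤v v≤count with v ≤? countAt m x
... | yes earlier = sighted-with-count m x v 2≤v earlier
... | no  now with x ≟ deckAt (suc m) 0
...   | yes x≡front = suc m , sym x≡front ,
          ≤-antisym (subst (_≤ v) (sym (see-hit {c = countAt m} x≡front)) (≰⇒> now)) v≤count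
...   | no  x≢front = ⊥-elim (now (subst (v ≤_) (see-miss {c = countAt m} x≢front) v≤count))

countAt-1-at-sighting : ∀ {i k} m → 2 ≤ i → 1 ≤ k → deckAt m 0 ≡ i → countAt m i ≡ suc k →
                         countAt m 1 < i + k
countAt-1-at-sighting {i} zero    i≥2 k≥1 _ count≡1+k =
  ⊥-elim (<⇒≱ (s≤s k≥1) (subst (_≤ 1) count≡1+k (count-initial i)))
countAt-1-at-sighting     (suc m) i≥2 k≥1 front count =
  InvariantProperties.count-of-1-at-sighting (invariantAt m) i≥2 k≥1 front count

sightings-ordered : ∀ {i k tᵢ t₁} → 2 ≤ i → 1 ≤ k → deckAt tᵢ 0 ≡ i → countAt tᵢ i ≡ suc k →
                    countAt t₁ 1 ≡ i + k → tᵢ < t₁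
sightings-ordered {tᵢ = tᵢ} i≥2 k≥1 i-front i-count 1-count = ≰⇒> λ t₁≤tᵢ →
  <⇒≱ (countAt-1-at-sighting tᵢ i≥2 k≥1 i-front i-count)
      (subst (_≤ countAt tᵢ 1) 1-count (count-mono 1 t₁≤tᵢ))

mainTheorem3 : (i k : ℕ) → i ≥ 2 → k ≥ 1 →
    Σ ℕ (λ t → Σ ℕ (λ s → SeenAt t i (1 + k) × SeenAt s 1 (i + k) × t < s))
mainTheorem3 i k i≥2 k≥1 =
  let m , i+k<N = maxSeen-unbounded (suc (i + k))
      I         = invariantAt m
      tᵢ , i-front , i-count =
        sighted-with-count (suc m) i (suc k) (s≤s k≥1)
          (count-lower I 1≤i (s≤s z≤n) (subst (_≤ maxSeen (suc m)) (sym (+-suc i k)) i+k<N))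
      t₁ , 1-front , 1-count =
        sighted-with-count (suc m) 1 (i + k) 2≤i+k
          (count-lower I ≤-refl (≤-trans (s≤s z≤n) 2≤i+k) i+k<N)
  in  suc tᵢ , suc t₁ , (i-front , i-count) , (1-front , 1-count)
    , s≤s (sightings-ordered i≥2 k≥1 i-front i-count 1-count)
  where
    open InvariantProperties using (count-lower)
    1≤i : 1 ≤ i
    1≤i = ≤-trans (s≤s z≤n) i≥2

    2≤i+k : 2 ≤ i + k
    2≤i+k = ≤-trans i≥2 (m≤m+n i k)
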